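{- Let $D$ be a disjunctive program with $n$ clauses $d_1,\ldots,d_n$, where each $d_i$ has empty body and exactly $h_i$ distinct atoms in its head. Then $D$ has at most $h_1\cdot h_2\cdots h_n$ answer sets. Moreover, if $D$ has exactly $h_1\cdots h_n$ answer sets, then no atom occurs in the heads of two different clauses of $D$.
   Context: A disjunctive program is a finite set of clauses $a_1\vee\cdots\vee a_k\leftarrow b_1,\ldots,b_p,\mathbf{not}(c_1),\ldots,\mathbf{not}(c_q)$ ($k\ge1$). A set of atoms $M$ satisfies a negation-free clause $a_1\vee\cdots\vee a_k\leftarrow b_1,\ldots,b_p$ if $\{b_1,\ldots,b_p\}\subseteq M$ implies some $a_i\in M$. The reduct $D^M$ is obtained by deleting every clause whose body contains $\mathbf{not}(c)$ with $c\in M$ and deleting all negative literals from the remaining clauses; $M$ is an answer set of $D$ if $M$ is a minimal model of $D^M$. -}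

module Defs where

open import Data.Nat using (ℕ; _*_)
import Data.Nat
open import Data.Fin using (Fin)
open import Data.Fin.Subset using (Subset; _∈_; _∉_; _⊆_)
open import Data.Fin.Subset.Properties using (_∈?_)
open import Data.List using (List; []; _∷_; length; map; foldr; lookup)
open import Data.List.NonEmpty using (List⁺; toList)
open import Data.List.Relation.Unary.All using (All)
open import Data.List.Relation.Unary.Any using (Any; any?)
open import Data.List.Relation.Unary.Unique.Propositional using (Unique)
open import Data.List.Membership.Propositional renaming (_∈_ to _∈ₗ_)
open import Data.Product using (_×_; Σ; ∃)
open import Relation.Binary.PropositionalEquality using (_≡_; _≢_)
open import Relation.Nullary using (yes; no)

-- Atoms are drawn from Fin m; a set of atoms is a Subset m.
-- A clause  a₁ ∨ … ∨ aₖ ← b₁,…,bₚ, not c₁,…,not c_q   (k ≥ 1)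
record Clause (m : ℕ) : Set where
  constructor clause
  field
    head    : List⁺ (Fin m)
    posBody : List (Fin m)
    negBody : List (Fin m)
open Clause public

record PosClause (m : ℕ) : Set where
  constructor posClause
  field
    pHead : List⁺ (Fin m)
    pBody : List (Fin m)
open PosClause public

Program : ℕ → Set
Program m = List (Clause m)

PosProgram : ℕ → Set
PosProgram m = List (PosClause m)

Satisfies : ∀ {m} → Subset m → PosClause m → Set
Satisfies M c = All (_∈ M) (pBody c) → Any (_∈ M) (toList (pHead c))

Model : ∀ {m} → PosProgram m → Subset m → Set
Model P M = All (Satisfies M) P

MinimalModel : ∀ {m} → PosProgram m → Subset m → Set
MinimalModel {m} P M =
  Model P M × (∀ (M′ : Subset m) → Model P M′ → M′ ⊆ M → M′ ≡ M)

reduct : ∀ {m} → Program m → Subset m → PosProgram m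
reduct [] M = []
reduct (c ∷ D) M with any? (_∈? M) (negBody c)
... | yes _ = reduct D M
... | no  _ = posClause (head c) (posBody c) ∷ reduct D M

AnswerSet : ∀ {m} → Program m → Subset m → Set
AnswerSet D M = MinimalModel (reduct D M) M

-- "D has at most k answer sets": every list of pairwise distinct answer sets has length ≤ k
AtMostAnswerSets : ∀ {m} → Program m → ℕ → Set
AtMostAnswerSets {m} D k =
  ∀ (L : List (Subset m)) → Unique L → All (AnswerSet D) L → Data.Nat._≤_ (length L) k

-- "D has exactly k answer sets": there is a duplicate-free list of length k
-- consisting of exactly the answer sets of D
ExactlyAnswerSets : ∀ {m} → Program m → ℕ → Set
ExactlyAnswerSets {m} D k =
  Σ (List (Subset m)) λ L →
    Unique L × All (AnswerSet D) L × (∀ M → AnswerSet D M → M ∈ₗ L) × length L ≡ k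

EmptyBody : ∀ {m} → Clause m → Set
EmptyBody c = posBody c ≡ [] × negBody c ≡ []

headSize : ∀ {m} → Clause m → ℕ
headSize c = length (toList (head c))

headProduct : ∀ {m} → Program m → ℕ
headProduct D = foldr _*_ 1 (map headSize D)

-- When every clause is a fact a₁ ∨ ⋯ ∨ aₖ, every reduct is the program itself, so the answer
-- sets are exactly the minimal hitting sets of the heads. Each minimal hitting set M is the set
-- of atoms of a choice function picking one atom of M from every head (those atoms already hit
-- every head), so there are at most h₁⋯hₙ answer sets. If an atom a lies in two heads dᵢ ≠ dⱼ,
-- one of them, say dⱼ, also has an atom b ≠ a (two equal facts would be the same clause). A
-- choice t′ with t′ᵢ = a and t′ⱼ = b is then dominated by t′[j ≔ a], whose atoms form a hitting
-- set contained in the atoms of t′. So t′ can only represent an answer set that t′[j ≔ a]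
-- already represents, and the h₁⋯hₙ choices yield fewer than h₁⋯hₙ answer sets.
{-# OPTIONS --safe #-}
module Submission where

open import Defs
open import Data.Nat using (ℕ)
open import Data.Fin using (Fin)
open import Data.List using (List; length; lookup)
open import Data.List.NonEmpty using (toList)
open import Data.List.Relation.Unary.All using (All)
open import Data.List.Relation.Unary.Unique.Propositional using (Unique)
open import Data.List.Membership.Propositional using (_∈_)
open import Data.Product using (_×_)
open import Relation.Binary.PropositionalEquality using (_≢_)
open import Relation.Nullary using (¬_)

open import Data.Nat using (suc; _+_; _*_; _≤_; _<_; z≤n; s≤s)
open import Data.Nat.Properties using (≤-trans; ≤-reflexive; <⇒≱; n<1+n; module ≤-Reasoning)
open import Data.Fin using (zero; suc; _≟_)
open import Data.Fin.Subset using (Subset; ⁅_⁆; _∪_; ⊥)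
  renaming (_∈_ to _∈ₛ_; _⊆_ to _⊆ₛ_)
open import Data.Fin.Subset.Properties using (∉⊥; x∈⁅x⁆; x∈⁅y⁆⇒x≡y; x∈p∪q⁺; x∈p∪q⁻)
open import Data.List using ([]; _∷_; _++_; map; cartesianProductWith)
open import Data.List.NonEmpty using (List⁺; _∷_)
import Data.List.NonEmpty as List⁺
open import Data.List.Properties using (length-map; length-++; length-++-sucʳ)
open import Data.List.Relation.Unary.Any using (Any; here; there)
import Data.List.Relation.Unary.All as All
open import Data.List.Relation.Unary.All using ([]; _∷_)
open import Data.List.Relation.Unary.AllPairs using ([]; _∷_)
open import Data.List.Relation.Binary.Subset.Propositional using (_⊆_)
open import Data.List.Membership.Propositional using (find; lose)
open import Data.List.Membership.Propositional.Properties
  using (∈-∃++; ∈-++⁻; ∈-++⁺ˡ; ∈-++⁺ʳ; ∈-map⁺; ∈-lookup; ∈-cartesianProductWith⁺)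
open import Data.Vec using (Vec; []; _∷_; tabulate; _[_]≔_)
import Data.Vec as Vec
open import Data.Vec.Properties using (lookup∘tabulate; lookup∘updateAt; lookup∘updateAt′)
open import Data.Product using (∃; _,_; proj₁; proj₂)
open import Data.Sum using (_⊎_; inj₁; inj₂)
open import Function using (_∘_)
open import Relation.Binary.PropositionalEquality
  using (_≡_; refl; sym; trans; cong; cong₂; subst; ≢-sym; module ≡-Reasoning)
open import Relation.Nullary using (yes; no; contradiction)

private
  variable
    A B C : Set
    m n : ℕ

∈-++-∷⁻ : ∀ (ys : List A) {zs x y} → x ∈ ys ++ y ∷ zs → x ≡ y ⊎ x ∈ ys ++ zs
∈-++-∷⁻ ys x∈ with ∈-++⁻ ys x∈
... | inj₁ x∈ys         = inj₂ (∈-++⁺ˡ x∈ys)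
... | inj₂ (here x≡y)   = inj₁ x≡y
... | inj₂ (there x∈zs) = inj₂ (∈-++⁺ʳ ys x∈zs)

∈-++-∷⁻-≢ : ∀ (ys : List A) {zs x y} → x ≢ y → x ∈ ys ++ y ∷ zs → x ∈ ys ++ zs
∈-++-∷⁻-≢ ys x≢y x∈ with ∈-++-∷⁻ ys x∈
... | inj₁ x≡y = contradiction x≡y x≢y
... | inj₂ x∈′ = x∈′

Unique-⊆⇒length≤ : ∀ {xs ys : List A} → Unique xs → xs ⊆ ys → length xs ≤ length ys
Unique-⊆⇒length≤ {xs = []}     _        _     = z≤n
Unique-⊆⇒length≤ {xs = x ∷ xs} (x∉ ∷ u) xs⊆ys
  with ys₁ , ys₂ , refl ← ∈-∃++ (xs⊆ys (here refl)) =
  ≤-trans (s≤s (Unique-⊆⇒length≤ u λ y∈ →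
                  ∈-++-∷⁻-≢ ys₁ (≢-sym (All.lookup x∉ y∈)) (xs⊆ys (there y∈))))
          (≤-reflexive (sym (length-++-sucʳ ys₁ x ys₂)))

Unique-lookup-injective : ∀ {xs : List A} → Unique xs → ∀ i j → lookup xs i ≡ lookup xs j → i ≡ j
Unique-lookup-injective {xs = _ ∷ _}  _        zero    zero    _  = refl
Unique-lookup-injective {xs = _ ∷ xs} (x∉ ∷ _) zero    (suc j) eq =
  contradiction eq (All.lookup x∉ (∈-lookup {xs = xs} j))
Unique-lookup-injective {xs = _ ∷ xs} (x∉ ∷ _) (suc i) zero    eq =
  contradiction (sym eq) (All.lookup x∉ (∈-lookup {xs = xs} i))
Unique-lookup-injective {xs = _ ∷ _}  (_ ∷ u)  (suc i) (suc j) eq =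
  cong suc (Unique-lookup-injective u i j eq)

length-cartesianProductWith : ∀ (f : A → B → C) xs ys →
  length (cartesianProductWith f xs ys) ≡ length xs * length ys
length-cartesianProductWith f []       ys = refl
length-cartesianProductWith f (x ∷ xs) ys = begin
  length (map (f x) ys ++ cartesianProductWith f xs ys)      ≡⟨ length-++ (map (f x) ys) ⟩
  length (map (f x) ys) + length (cartesianProductWith f xs ys)
    ≡⟨ cong₂ _+_ (length-map (f x) ys) (length-cartesianProductWith f xs ys) ⟩
  length ys + length xs * length ys                           ∎
  where open ≡-Reasoning

Unique⁺-singleton⊎other : ∀ {l : List⁺ (Fin m)} {a} → Unique (toList l) → a ∈ toList l →
  l ≡ a ∷ [] ⊎ ∃ λ b → b ∈ toList l × b ≢ a
Unique⁺-singleton⊎other {l = x ∷ []}    _        (here refl) = inj₁ refl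
Unique⁺-singleton⊎other {l = x ∷ y ∷ _} {a} (x∉ ∷ _) _ with x ≟ a
... | no x≢a   = inj₂ (x , here refl , x≢a)
... | yes refl = inj₂ (y , there (here refl) , ≢-sym (All.head x∉))

atoms : Vec (Fin m) n → Subset m
atoms []      = ⊥
atoms (x ∷ t) = ⁅ x ⁆ ∪ atoms t

lookup∈atoms : ∀ (t : Vec (Fin m) n) k → Vec.lookup t k ∈ₛ atoms t
lookup∈atoms (x ∷ t) zero    = x∈p∪q⁺ (inj₁ (x∈⁅x⁆ x))
lookup∈atoms (x ∷ t) (suc k) = x∈p∪q⁺ (inj₂ (lookup∈atoms t k))

∈atoms⇒∃lookup : ∀ (t : Vec (Fin m) n) {y} → y ∈ₛ atoms t → ∃ λ k → Vec.lookup t k ≡ y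
∈atoms⇒∃lookup []      y∈ = contradiction y∈ ∉⊥
∈atoms⇒∃lookup (x ∷ t) y∈ with x∈p∪q⁻ ⁅ x ⁆ (atoms t) y∈
... | inj₁ y∈⁅x⁆ = zero , sym (x∈⁅y⁆⇒x≡y x y∈⁅x⁆)
... | inj₂ y∈t   = let k , t[k]≡y = ∈atoms⇒∃lookup t y∈t in suc k , t[k]≡y

atoms⊆ : ∀ (t : Vec (Fin m) n) {S} → (∀ k → Vec.lookup t k ∈ₛ S) → atoms t ⊆ₛ S
atoms⊆ t t⊆S y∈ with ∈atoms⇒∃lookup t y∈
... | k , refl = t⊆S k

atoms-tabulate-⊆ : ∀ (f : Fin n → Fin m) {S} → (∀ k → f k ∈ₛ S) → atoms (tabulate f) ⊆ₛ S
atoms-tabulate-⊆ f {S} f⊆S =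
  atoms⊆ (tabulate f) λ k → subst (_∈ₛ S) (sym (lookup∘tabulate f k)) (f⊆S k)

atoms-[]≔-⊆ : ∀ (t : Vec (Fin m) n) j {x} → x ∈ₛ atoms t → atoms (t [ j ]≔ x) ⊆ₛ atoms t
atoms-[]≔-⊆ t j {x} x∈t = atoms⊆ (t [ j ]≔ x) entry
  where
    entry : ∀ k → Vec.lookup (t [ j ]≔ x) k ∈ₛ atoms t
    entry k with k ≟ j
    ... | yes refl = subst (_∈ₛ atoms t) (sym (lookup∘updateAt k t)) x∈t
    ... | no k≢j   = subst (_∈ₛ atoms t) (sym (lookup∘updateAt′ k j k≢j t)) (lookup∈atoms t k)

headAtoms : Clause m → List (Fin m)
headAtoms c = toList (head c)

EmptyBody-head-injective : ∀ {c c′ : Clause m} →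
  EmptyBody c → EmptyBody c′ → head c ≡ head c′ → c ≡ c′
EmptyBody-head-injective (refl , refl) (refl , refl) refl = refl

HittingSet : Program m → Subset m → Set
HittingSet D T = ∀ k → Any (_∈ₛ T) (headAtoms (lookup D k))

MinimalHittingSet : Program m → Subset m → Set
MinimalHittingSet {m} D M = HittingSet D M × (∀ (T : Subset m) → HittingSet D T → T ⊆ₛ M → T ≡ M)

model⇒HittingSet : ∀ {D : Program m} {M T} →
  All EmptyBody D → Model (reduct D M) T → HittingSet D T
model⇒HittingSet {D = clause _ _ _ ∷ _} ((refl , refl) ∷ _)  (sat ∷ _)   zero    = sat []
model⇒HittingSet {D = clause _ _ _ ∷ _} ((refl , refl) ∷ eD) (_ ∷ model) (suc k) =
  model⇒HittingSet eD model k

HittingSet⇒model : ∀ {D : Program m} {M T} →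
  All EmptyBody D → HittingSet D T → Model (reduct D M) T
HittingSet⇒model {D = []}               []                   _    = []
HittingSet⇒model {D = clause _ _ _ ∷ _} ((refl , refl) ∷ eD) hits =
  (λ _ → hits zero) ∷ HittingSet⇒model eD (hits ∘ suc)

answerSet⇒MinimalHittingSet : ∀ {D : Program m} {M} →
  All EmptyBody D → AnswerSet D M → MinimalHittingSet D M
answerSet⇒MinimalHittingSet eD (model , minimal) =
  model⇒HittingSet eD model , λ T hits T⊆M → minimal T (HittingSet⇒model eD hits) T⊆M

record Choice (D : Program m) (t : Vec (Fin m) (length D)) : Set where
  constructor choice
  field
    ∈head : ∀ k → Vec.lookup t k ∈ headAtoms (lookup D k)
open Choice

choices : (D : Program m) → List (Vec (Fin m) (length D))
choices []      = [] ∷ []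
choices (c ∷ D) = cartesianProductWith _∷_ (headAtoms c) (choices D)

length-choices : ∀ (D : Program m) → length (choices D) ≡ headProduct D
length-choices []      = refl
length-choices (c ∷ D) =
  trans (length-cartesianProductWith _∷_ (headAtoms c) (choices D))
        (cong (headSize c *_) (length-choices D))

Choice⇒∈choices : ∀ {D : Program m} {t} → Choice D t → t ∈ choices D
Choice⇒∈choices {D = []}    {[]}    _  = here refl
Choice⇒∈choices {D = _ ∷ D} {_ ∷ _} ch =
  ∈-cartesianProductWith⁺ _∷_ (∈head ch zero) (Choice⇒∈choices {D = D} (choice (∈head ch ∘ suc)))

Choice-tabulate : ∀ {D : Program m} f →
  (∀ k → f k ∈ headAtoms (lookup D k)) → Choice D (tabulate f)
Choice-tabulate {D = D} f f∈ =
  choice λ k → subst (_∈ headAtoms (lookup D k)) (sym (lookup∘tabulate f k)) (f∈ k)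

firstChoice : (D : Program m) → Vec (Fin m) (length D)
firstChoice D = tabulate (λ k → List⁺.head (head (lookup D k)))

Choice-firstChoice : ∀ (D : Program m) → Choice D (firstChoice D)
Choice-firstChoice D = Choice-tabulate {D = D} _ (λ _ → here refl)

Choice-[]≔ : ∀ {D : Program m} {t j x} →
  Choice D t → x ∈ headAtoms (lookup D j) → Choice D (t [ j ]≔ x)
Choice-[]≔ {D = D} {t} {j} {x} ch x∈ = choice entry
  where
    entry : ∀ k → Vec.lookup (t [ j ]≔ x) k ∈ headAtoms (lookup D k)
    entry k with k ≟ j
    ... | yes refl = subst (_∈ _) (sym (lookup∘updateAt k t)) x∈
    ... | no k≢j   = subst (_∈ _) (sym (lookup∘updateAt′ k j k≢j t)) (∈head ch k)

Choice⇒HittingSet : ∀ {D : Program m} {t} → Choice D t → HittingSet D (atoms t)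
Choice⇒HittingSet {t = t} ch k = lose (∈head ch k) (lookup∈atoms t k)

HittingSet⇒Choice⊆ : ∀ {D : Program m} {M} →
  HittingSet D M → ∃ λ t → Choice D t × atoms t ⊆ₛ M
HittingSet⇒Choice⊆ {D = D} hits =
  tabulate pick , Choice-tabulate {D = D} pick (proj₁ ∘ proj₂ ∘ find ∘ hits) ,
  atoms-tabulate-⊆ pick (proj₂ ∘ proj₂ ∘ find ∘ hits)
  where
    pick : Fin (length D) → Fin _
    pick = proj₁ ∘ find ∘ hits

AnswerSetsIn : Program m → List (Subset m) → Set
AnswerSetsIn D ys = ∀ {M} → AnswerSet D M → M ∈ ys

answerSetsIn⇒atMost : ∀ {D : Program m} {ys} → AnswerSetsIn D ys → AtMostAnswerSets D (length ys)
answerSetsIn⇒atMost inYs L u asL = Unique-⊆⇒length≤ u (inYs ∘ All.lookup asL)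

answerSetsIn⇒¬exactly : ∀ {D : Program m} {ys k} →
  AnswerSetsIn D ys → length ys < k → ¬ ExactlyAnswerSets D k
answerSetsIn⇒¬exactly {D = D} inYs shorter (L , u , asL , _ , refl) =
  <⇒≱ shorter (answerSetsIn⇒atMost {D = D} inYs L u asL)

module _ {D : Program m} (eD : All EmptyBody D) where

  answerSet⇒atoms-Choice : ∀ {M} → AnswerSet D M → ∃ λ t → Choice D t × atoms t ≡ M
  answerSet⇒atoms-Choice asM =
    let hits , minimal = answerSet⇒MinimalHittingSet eD asM
        t , ch , t⊆M   = HittingSet⇒Choice⊆ hits
    in t , ch , minimal (atoms t) (Choice⇒HittingSet ch) t⊆M

  answerSetsIn-choices : AnswerSetsIn D (map atoms (choices D))
  answerSetsIn-choices asM with t , ch , refl ← answerSet⇒atoms-Choice asM =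
    ∈-map⁺ atoms (Choice⇒∈choices ch)

  answerSetsIn-without : ∀ {ts₁ ts₂ t t′} → choices D ≡ ts₁ ++ t′ ∷ ts₂ →
    Choice D t → t ≢ t′ → atoms t ⊆ₛ atoms t′ → AnswerSetsIn D (map atoms (ts₁ ++ ts₂))
  answerSetsIn-without {ts₁} {ts₂} {t} split ch t≢t′ t⊆t′ asM
    with s , chs , refl ← answerSet⇒atoms-Choice asM
    with ∈-++-∷⁻ ts₁ (subst (s ∈_) split (Choice⇒∈choices chs))
  ... | inj₂ s∈ = ∈-map⁺ atoms s∈
  ... | inj₁ refl = subst (_∈ _) atoms-t≡atoms-t′ (∈-map⁺ atoms t∈)
    where
      atoms-t≡atoms-t′ : atoms t ≡ atoms s
      atoms-t≡atoms-t′ =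
        proj₂ (answerSet⇒MinimalHittingSet eD asM) (atoms t) (Choice⇒HittingSet ch) t⊆t′
      t∈ : t ∈ ts₁ ++ ts₂
      t∈ = ∈-++-∷⁻-≢ ts₁ t≢t′ (subst (t ∈_) split (Choice⇒∈choices ch))

  dominatedChoice⇒¬exactly : ∀ {t t′} → Choice D t → Choice D t′ → t ≢ t′ → atoms t ⊆ₛ atoms t′ →
    ¬ ExactlyAnswerSets D (headProduct D)
  dominatedChoice⇒¬exactly {t′ = t′} ch ch′ t≢t′ t⊆t′
    with ts₁ , ts₂ , split ← ∈-∃++ (Choice⇒∈choices ch′) =
    answerSetsIn⇒¬exactly {D = D} (answerSetsIn-without split ch t≢t′ t⊆t′) shorter
    where
      open ≤-Reasoning
      shorter : length (map atoms (ts₁ ++ ts₂)) < headProduct D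
      shorter = begin-strict
        length (map atoms (ts₁ ++ ts₂)) ≡⟨ length-map atoms (ts₁ ++ ts₂) ⟩
        length (ts₁ ++ ts₂)             <⟨ n<1+n _ ⟩
        suc (length (ts₁ ++ ts₂))       ≡⟨ length-++-sucʳ ts₁ t′ ts₂ ⟨
        length (ts₁ ++ t′ ∷ ts₂)        ≡⟨ cong length split ⟨
        length (choices D)              ≡⟨ length-choices D ⟩
        headProduct D                   ∎

  sharedAtom⇒¬exactly : ∀ {i j a b} → i ≢ j →
    a ∈ headAtoms (lookup D i) → a ∈ headAtoms (lookup D j) → b ∈ headAtoms (lookup D j) → b ≢ a →
    ¬ ExactlyAnswerSets D (headProduct D)
  sharedAtom⇒¬exactly {i} {j} {a} {b} i≢j a∈i a∈j b∈j b≢a =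
    dominatedChoice⇒¬exactly (Choice-[]≔ ch′ a∈j) ch′ t≢t′ (atoms-[]≔-⊆ t′ j a∈t′)
    where
      t′ : Vec (Fin m) (length D)
      t′ = (firstChoice D [ i ]≔ a) [ j ]≔ b
      ch′ : Choice D t′
      ch′ = Choice-[]≔ (Choice-[]≔ (Choice-firstChoice D) a∈i) b∈j
      t′[i]≡a : Vec.lookup t′ i ≡ a
      t′[i]≡a = trans (lookup∘updateAt′ i j i≢j (firstChoice D [ i ]≔ a))
                      (lookup∘updateAt i (firstChoice D))
      a∈t′ : a ∈ₛ atoms t′
      a∈t′ = subst (_∈ₛ atoms t′) t′[i]≡a (lookup∈atoms t′ i)
      t≢t′ : t′ [ j ]≔ a ≢ t′
      t≢t′ eq = b≢a (begin
        b                          ≡⟨ lookup∘updateAt j (firstChoice D [ i ]≔ a) ⟨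
        Vec.lookup t′ j            ≡⟨ cong (λ v → Vec.lookup v j) eq ⟨
        Vec.lookup (t′ [ j ]≔ a) j ≡⟨ lookup∘updateAt j t′ ⟩
        a                          ∎)
        where open ≡-Reasoning

  overlappingHeads⇒¬exactly : Unique D → All (λ c → Unique (headAtoms c)) D → ∀ {i j a} → i ≢ j →
    a ∈ headAtoms (lookup D i) → a ∈ headAtoms (lookup D j) →
    ¬ ExactlyAnswerSets D (headProduct D)
  overlappingHeads⇒¬exactly uD uH {i} {j} i≢j a∈i a∈j
    with Unique⁺-singleton⊎other (All.lookup uH (∈-lookup {xs = D} j)) a∈j
       | Unique⁺-singleton⊎other (All.lookup uH (∈-lookup {xs = D} i)) a∈i
  ... | inj₂ (b , b∈j , b≢a) | _                    = sharedAtom⇒¬exactly i≢j a∈i a∈j b∈j b≢a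
  ... | inj₁ _               | inj₂ (b , b∈i , b≢a) =
    sharedAtom⇒¬exactly (≢-sym i≢j) a∈j a∈i b∈i b≢a
  ... | inj₁ Dj≡[a]          | inj₁ Di≡[a]          =
    contradiction (Unique-lookup-injective uD i j Di≡Dj) i≢j
    where
      Di≡Dj : lookup D i ≡ lookup D j
      Di≡Dj = EmptyBody-head-injective (All.lookup eD (∈-lookup {xs = D} i))
                                       (All.lookup eD (∈-lookup {xs = D} j))
                                       (trans Di≡[a] (sym Dj≡[a]))

lemma9 : ∀ (m : ℕ) (D : Program m) →
    Unique D →
    All EmptyBody D →
    All (λ c → Unique (toList (head c))) D →
    AtMostAnswerSets D (headProduct D)
      × (ExactlyAnswerSets D (headProduct D) →
          ∀ (i j : Fin (length D)) → i ≢ j → ∀ (a : Fin m) →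
            ¬ (a ∈ toList (head (lookup D i)) × a ∈ toList (head (lookup D j))))
lemma9 m D uD eD uH = atMost , exactly⇒disjoint
  where
    atMost : AtMostAnswerSets D (headProduct D)
    atMost = subst (AtMostAnswerSets D) (trans (length-map atoms (choices D)) (length-choices D))
                   (answerSetsIn⇒atMost {D = D} (answerSetsIn-choices eD))

    exactly⇒disjoint : ExactlyAnswerSets D (headProduct D) → ∀ i j → i ≢ j → ∀ a →
      ¬ (a ∈ headAtoms (lookup D i) × a ∈ headAtoms (lookup D j))
    exactly⇒disjoint exactly i j i≢j a (a∈i , a∈j) =
      overlappingHeads⇒¬exactly eD uD uH i≢j a∈i a∈j exactly
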